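{- Let $G$ be a connected graph of diameter $2$ and let $x$ be a vertex of $G$. Then ${\rm gp}(G-x)\le {\rm gp}(G)$.
   Context: All graphs are simple. A set $X\subseteq V(G)$ is a general position set of $G$ if for every pair of distinct $u,v\in X$ and every shortest $u,v$-path $P$ in $G$ we have $V(P)\cap X=\{u,v\}$ (vertices in different components impose no condition). ${\rm gp}(G)$ is the maximum cardinality of a general position set of $G$. $G-x$ is the subgraph induced by $V(G)\setminus\{x\}$; the diameter is the maximum distance between two vertices. -}

module Defs where

open import Data.Nat using (ℕ; zero; suc; _≤_)
open import Data.Fin using (Fin; punchIn)
open import Data.Fin.Subset using (Subset; _∈_; ∣_∣)
open import Data.List using (List; []; _∷_)
import Data.List.Membership.Propositional as LM
open import Data.Product using (Σ; ∃; _×_)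
open import Data.Sum using (_⊎_)
open import Data.Empty using (⊥)
open import Relation.Nullary using (¬_)
open import Relation.Binary.PropositionalEquality using (_≡_)

record Graph (n : ℕ) : Set₁ where
  field
    Adj    : Fin n → Fin n → Set
    sym    : ∀ {u v} → Adj u v → Adj v u
    irrefl : ∀ {u} → ¬ Adj u u
open Graph public

data Walk {n : ℕ} (G : Graph n) : Fin n → Fin n → ℕ → Set where
  nil  : ∀ {u} → Walk G u u 0
  cons : ∀ {u w v k} → Adj G u w → Walk G w v k → Walk G u v (suc k)

vertices : ∀ {n} {G : Graph n} {u v k} → Walk G u v k → List (Fin n)
vertices {u = u} nil = u ∷ []
vertices {u = u} (cons _ p) = u ∷ vertices p

IsShortest : ∀ {n} (G : Graph n) {u v k} → Walk G u v k → Set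
IsShortest G {u} {v} {k} _ = ∀ k' → Walk G u v k' → k ≤ k'

Dist : ∀ {n} → Graph n → Fin n → Fin n → ℕ → Set
Dist G u v d = Walk G u v d × (∀ k' → Walk G u v k' → d ≤ k')

Connected : ∀ {n} → Graph n → Set
Connected G = ∀ u v → ∃ λ k → Walk G u v k

HasDiameter : ∀ {n} → Graph n → ℕ → Set
HasDiameter G d =
  (∀ u v → ∃ λ k → k ≤ d × Walk G u v k) × (∃ λ u → ∃ λ v → Dist G u v d)

IsGPSet : ∀ {n} → Graph n → Subset n → Set
IsGPSet G X =
  ∀ {u v k} → u ∈ X → v ∈ X → ¬ (u ≡ v) →
  (P : Walk G u v k) → IsShortest G P →
  ∀ w → w LM.∈ vertices P → w ∈ X → (w ≡ u ⊎ w ≡ v)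

IsGPNumber : ∀ {n} → Graph n → ℕ → Set
IsGPNumber G m =
  (Σ _ λ X → IsGPSet G X × ∣ X ∣ ≡ m) × (∀ X → IsGPSet G X → ∣ X ∣ ≤ m)

deleteVertex : ∀ {n} → Graph (suc n) → Fin (suc n) → Graph n
deleteVertex G x = record
  { Adj    = λ i j → Adj G (punchIn x i) (punchIn x j)
  ; sym    = sym G
  ; irrefl = irrefl G
  }

{-# OPTIONS --safe #-}
module Submission where

-- In a graph of diameter at most 2 every geodesic has at most one inner vertex.
-- A general position set S of G - x, viewed inside G, could only fail to be in
-- general position because of a geodesic u m v of G with u, m, v ∈ S. Such a
-- path avoids x, so it is a path of G - x, and it is a geodesic there because
-- deleting a vertex cannot shorten distances; hence m ∈ {u, v}.

open import Defs
open import Data.Nat using (ℕ; suc; _≤_; s≤s)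
open import Data.Nat.Properties using (≤-trans)
open import Data.Fin using (Fin; zero; suc; punchIn)
open import Data.Fin.Subset using (Subset; _∈_; ∣_∣; outside; inside)
open import Data.Vec using (_∷_; here; there; insertAt)
open import Data.List.Relation.Unary.Any using (here; there)
open import Data.Product using (Σ-syntax; ∃; _×_; _,_)
open import Data.Sum using (_⊎_; inj₁; inj₂)
open import Data.Empty using (⊥-elim)
open import Relation.Nullary using (¬_)
open import Relation.Binary.PropositionalEquality using (_≡_; refl; cong; subst)

punchInSubset : ∀ {n} → Fin (suc n) → Subset n → Subset (suc n)
punchInSubset x S = insertAt S x outside

∈-punchInSubset⁻ : ∀ {n} (x : Fin (suc n)) {S : Subset n} {y} →
                   y ∈ punchInSubset x S → Σ[ i ∈ Fin n ] y ≡ punchIn x i × i ∈ S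
∈-punchInSubset⁻ zero                    (there y∈S) = _ , refl , y∈S
∈-punchInSubset⁻ (suc x) {_ ∷ _} {zero}  here        = zero , refl , here
∈-punchInSubset⁻ (suc x) {_ ∷ _} {suc y} (there y∈S) with ∈-punchInSubset⁻ x y∈S
... | i , refl , i∈S = suc i , refl , there i∈S

∣punchInSubset∣ : ∀ {n} (x : Fin (suc n)) (S : Subset n) → ∣ punchInSubset x S ∣ ≡ ∣ S ∣
∣punchInSubset∣ zero    S             = refl
∣punchInSubset∣ (suc x) (inside  ∷ S) = cong suc (∣punchInSubset∣ x S)
∣punchInSubset∣ (suc x) (outside ∷ S) = ∣punchInSubset∣ x S

liftWalk : ∀ {n} (G : Graph (suc n)) (x : Fin (suc n)) {u v k} →
           Walk (deleteVertex G x) u v k → Walk G (punchIn x u) (punchIn x v) k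
liftWalk G x nil        = nil
liftWalk G x (cons e P) = cons e (liftWalk G x P)

isShortest-deleteVertex : ∀ {n} (G : Graph (suc n)) (x : Fin (suc n)) {u v k}
                          (P : Walk (deleteVertex G x) u v k) →
                          IsShortest G (liftWalk G x P) → IsShortest (deleteVertex G x) P
isShortest-deleteVertex G x P shortest k Q = shortest k (liftWalk G x Q)

shortest⇒length≤diameter : ∀ {n} (G : Graph n) {d} →
                            (∀ u v → ∃ λ k → k ≤ d × Walk G u v k) →
                            ∀ {u v k} (P : Walk G u v k) → IsShortest G P → k ≤ d
shortest⇒length≤diameter G bounded {u} {v} P shortest with bounded u v
... | k , k≤d , Q = ≤-trans (shortest k Q) k≤d

isGPSet-fromMiddles : ∀ {n} (G : Graph n) {X : Subset n} →
  (∀ {u v k} (P : Walk G u v k) → IsShortest G P → k ≤ 2) →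
  (∀ {u m v} → u ∈ X → m ∈ X → v ∈ X → ¬ u ≡ v →
     (e : Adj G u m) (f : Adj G m v) → IsShortest G (cons e (cons f nil)) →
     m ≡ u ⊎ m ≡ v) →
  IsGPSet G X
isGPSet-fromMiddles G _ _ _ _ u≢v nil _ _ _ _ = ⊥-elim (u≢v refl)
isGPSet-fromMiddles G _ _ _ _ _ (cons _ nil) _ _ (here w≡u)         _ = inj₁ w≡u
isGPSet-fromMiddles G _ _ _ _ _ (cons _ nil) _ _ (there (here w≡v)) _ = inj₂ w≡v
isGPSet-fromMiddles G _ _ _ _ _ (cons _ (cons _ nil)) _ _ (here w≡u)                 _ = inj₁ w≡u
isGPSet-fromMiddles G _ _ _ _ _ (cons _ (cons _ nil)) _ _ (there (there (here w≡v))) _ = inj₂ w≡v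
isGPSet-fromMiddles G _ middle uX vX u≢v (cons e (cons f nil)) shortest _ (there (here refl)) wX =
  middle uX wX vX u≢v e f shortest
isGPSet-fromMiddles G short≤2 _ _ _ _ P@(cons _ (cons _ (cons _ _))) shortest _ _ _
  with short≤2 P shortest
... | s≤s (s≤s ())

isGPSet-punchInSubset : ∀ {n} (G : Graph (suc n)) →
  (∀ u v → ∃ λ k → k ≤ 2 × Walk G u v k) →
  (x : Fin (suc n)) {S : Subset n} →
  IsGPSet (deleteVertex G x) S → IsGPSet G (punchInSubset x S)
isGPSet-punchInSubset G diameter≤2 x {S} gpS =
  isGPSet-fromMiddles G (shortest⇒length≤diameter G diameter≤2) middle
  where
  middle : ∀ {u m v} → u ∈ punchInSubset x S → m ∈ punchInSubset x S → v ∈ punchInSubset x S →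
           ¬ u ≡ v → (e : Adj G u m) (f : Adj G m v) → IsShortest G (cons e (cons f nil)) →
           m ≡ u ⊎ m ≡ v
  middle uX mX vX u≢v e f shortest
    with ∈-punchInSubset⁻ x uX | ∈-punchInSubset⁻ x mX | ∈-punchInSubset⁻ x vX
  ... | u , refl , uS | m , refl , mS | v , refl , vS
    with gpS uS vS (λ u≡v → u≢v (cong (punchIn x) u≡v)) (cons e (cons f nil))
             (isShortest-deleteVertex G x (cons e (cons f nil)) shortest)
             m (there (here refl)) mS
  ... | inj₁ m≡u = inj₁ (cong (punchIn x) m≡u)
  ... | inj₂ m≡v = inj₂ (cong (punchIn x) m≡v)

proposition5p1 : ∀ {n} (G : Graph (suc n)) → Connected G → HasDiameter G 2 →
    (x : Fin (suc n)) → (a b : ℕ) →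
    IsGPNumber (deleteVertex G x) a → IsGPNumber G b → a ≤ b
proposition5p1 G _ (diameter≤2 , _) x a b ((S , gpS , refl) , _) (_ , maximal) =
  subst (_≤ b) (∣punchInSubset∣ x S)
    (maximal (punchInSubset x S) (isGPSet-punchInSubset G diameter≤2 x gpS))
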